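{- Let $H$ be the directed graph with vertex set $\mathbb{Z}_{12}=\{0,1,\dots,11\}$ in which, for each $i\in\mathbb{Z}_{12}$, there are arcs $i\to i+2 \pmod{12}$, $i\to i+3 \pmod{12}$ and $i\to i+8 \pmod{12}$, and no other arcs (i.e. $H=\operatorname{Cay}(\mathbb{Z}_{12};\{2,3,8\})$). Then $H$ is a $3$-diregular oriented graph on $12\le 4\cdot 3+1$ vertices that contains no directed Hamiltonian cycle. In particular, the following statement is false: every $k$-diregular oriented graph on at most $4k+1$ vertices, where $k\neq 2$, contains a directed Hamiltonian cycle.
   Context: A digraph is $k$-diregular if every vertex has in-degree $k$ and out-degree $k$. An oriented graph is a digraph with no loops, no multiple arcs, and no pair of opposite arcs $u\to v$, $v\to u$. A directed Hamiltonian cycle (circuit) is a directed cycle passing through every vertex exactly once. -}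

module Defs where

open import Data.Nat using (ℕ; zero; suc; _+_; _*_; _≤_)
open import Data.Fin using (Fin; toℕ)
open import Data.Fin.Properties using (_≟_)
open import Data.List using (List; []; _∷_; length; filter; allFin)
open import Data.List.Relation.Binary.Permutation.Propositional using (_↭_)
open import Data.Product using (_×_; Σ; ∃; _,_)
open import Data.Sum using (_⊎_)
open import Data.Empty using (⊥)
open import Relation.Nullary using (¬_; Dec)
open import Relation.Binary.PropositionalEquality using (_≡_)
open import Data.Nat.DivMod using (_mod_)

-- A (simple) digraph on the vertex set Fin n, given by a decidable arc relation.
-- Since arcs form a relation, there are no multiple arcs.
record Digraph (n : ℕ) : Set₁ where
  field
    Arc  : Fin n → Fin n → Set
    arc? : (u v : Fin n) → Dec (Arc u v)
open Digraph public

outDeg : ∀ {n} → Digraph n → Fin n → ℕ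
outDeg G u = length (filter (λ v → arc? G u v) (allFin _))

inDeg : ∀ {n} → Digraph n → Fin n → ℕ
inDeg G v = length (filter (λ u → arc? G u v) (allFin _))

Diregular : ∀ {n} → ℕ → Digraph n → Set
Diregular k G = ∀ v → inDeg G v ≡ k × outDeg G v ≡ k

Oriented : ∀ {n} → Digraph n → Set
Oriented G = (∀ v → ¬ Arc G v v) × (∀ u v → Arc G u v → ¬ Arc G v u)

PathArcs : ∀ {n} → Digraph n → Fin n → List (Fin n) → Set
PathArcs G x [] = Data.Unit.⊤
  where import Data.Unit
PathArcs G x (y ∷ ys) = Arc G x y × PathArcs G y ys

lastFrom : ∀ {n} → Fin n → List (Fin n) → Fin n
lastFrom x [] = x
lastFrom x (y ∷ ys) = lastFrom y ys

HamiltonianCycle : ∀ {n} → Digraph n → Set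
HamiltonianCycle {n} G =
  Σ (Fin n) λ x → Σ (List (Fin n)) λ xs →
    ((x ∷ xs) ↭ allFin n) × PathArcs G x xs × Arc G (lastFrom x xs) x

_+₁₂_ : Fin 12 → ℕ → Fin 12
i +₁₂ s = (toℕ i + s) mod 12

H : Digraph 12
H = record
  { Arc  = λ i j → (j ≡ i +₁₂ 2) ⊎ (j ≡ i +₁₂ 3) ⊎ (j ≡ i +₁₂ 8)
  ; arc? = λ i j → (j ≟ i +₁₂ 2) ⊎-dec ((j ≟ i +₁₂ 3) ⊎-dec (j ≟ i +₁₂ 8))
  }
  where open import Relation.Nullary.Decidable using (_⊎-dec_)

-- H is a circulant digraph, so diregularity is immediate, and it is oriented
-- because no two of the connection set {2, 3, 8} (nor any one alone) sum to
-- 0 mod 12; both facts are checked by deciding them vertex by vertex. For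
-- non-Hamiltonicity, a depth-first search from each start vertex extends the
-- walk only along arcs to unvisited vertices and succeeds iff it can close a
-- cycle after visiting all 12 vertices. Every Hamiltonian cycle is a branch of
-- this search, and evaluating it on H shows that no branch succeeds.
module Submission where

open import Defs
open import Data.Nat using (ℕ; _+_; _*_; _≤_)
open import Data.Product using (_×_)
open import Relation.Nullary using (¬_)
open import Relation.Binary.PropositionalEquality using (_≢_)

open import Data.Bool using (Bool; T; not; true; _∧_)
open import Data.Bool.ListAction using (any; all)
open import Data.Bool.Properties using (T-∧; T-≡; T-not-≡)
open import Data.Fin using (Fin)
open import Data.Fin.Properties using (all?) renaming (_≟_ to _≟ᶠ_)
open import Data.List using (List; []; _∷_; length; allFin)
open import Data.List.Properties using (length-tabulate)
open import Data.List.Membership.Propositional using (_∈_; _∉_)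
open import Data.List.Membership.Propositional.Properties using (∈-allFin)
import Data.List.Membership.DecPropositional as DecMembership
open import Data.List.Relation.Binary.Permutation.Propositional using (↭⇒↭ₛ; ↭-sym)
open import Data.List.Relation.Binary.Permutation.Propositional.Properties using (↭-length)
import Data.List.Relation.Binary.Permutation.Setoid.Properties as PermutationSetoid
open import Data.List.Relation.Unary.All as All using (All)
open import Data.List.Relation.Unary.All.Properties using (all⁺)
open import Data.List.Relation.Unary.Any as Any using (here; there)
open import Data.List.Relation.Unary.Any.Properties using (any⁺)
open import Data.List.Relation.Unary.AllPairs as AllPairs using (_∷_)
open import Data.List.Relation.Unary.Unique.Propositional using (Unique)
open import Data.List.Relation.Unary.Unique.Propositional.Properties using (allFin⁺)
open import Data.Nat using (zero; suc; pred; s≤s; z≤n) renaming (_≟_ to _≟ⁿ_)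
open import Data.Nat.Properties using (n≤1+n)
open import Data.Product using (_,_)
open import Data.Sum using (inj₁; inj₂)
open import Function using (id)
open import Function.Bundles using (Equivalence)
open import Relation.Nullary.Decidable using (isYes; from-yes; fromWitness; ¬?; _×-dec_; _→-dec_)
open import Relation.Binary.PropositionalEquality using (_≡_; refl; sym; trans; cong; subst; setoid)

module _ {n} (G : Digraph n) where

  open DecMembership (_≟ᶠ_ {n}) using (_∉?_)

  -- u and v are explicit: they cannot be inferred from Arc G u v.
  ListsOutNeighbours : (Fin n → List (Fin n)) → Set
  ListsOutNeighbours out = ∀ u v → Arc G u v → v ∈ out u

  -- closable out x k vis cur: a walk that has visited vis and stands at cur
  -- continues along k arcs to pairwise distinct unvisited vertices and then
  -- returns to x.
  closable : (Fin n → List (Fin n)) → Fin n → ℕ → List (Fin n) → Fin n → Bool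
  closable out x zero    vis cur = isYes (arc? G cur x)
  closable out x (suc k) vis cur =
    any (λ y → isYes (y ∉? vis) ∧ closable out x k (y ∷ vis) y) (out cur)

  closable-complete : ∀ {out} → ListsOutNeighbours out →
    ∀ x vis cur ys → PathArcs G cur ys → Arc G (lastFrom cur ys) x →
    Unique ys → All (_∉ vis) ys → T (closable out x (length ys) vis cur)
  closable-complete lists x vis cur [] _ back _ _ = fromWitness {a? = arc? G cur x} back
  closable-complete {out} lists x vis cur (y ∷ ys) (cur→y , path) back
                    (y∉ys ∷ ys-unique) (y∉vis All.∷ ys∉vis) =
    any⁺ (λ z → isYes (z ∉? vis) ∧ closable out x (length ys) (z ∷ vis) z)
         (Any.map (λ { refl → continue }) (lists cur y cur→y))
    where
    ys∉y∷vis : All (_∉ y ∷ vis) ys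
    ys∉y∷vis = All.zipWith (λ { (y≢z , z∉vis) → λ { (here z≡y)    → y≢z (sym z≡y)
                                                  ; (there z∈vis) → z∉vis z∈vis } })
                           (y∉ys , ys∉vis)

    continue : T (isYes (y ∉? vis) ∧ closable out x (length ys) (y ∷ vis) y)
    continue = Equivalence.from T-∧
      ( fromWitness {a? = y ∉? vis} y∉vis
      , closable-complete lists x (y ∷ vis) y ys path back ys-unique ys∉y∷vis )

  not-closable⇒non-hamiltonian : ∀ {out} → ListsOutNeighbours out →
    all (λ x → not (closable out x (pred n) (x ∷ []) x)) (allFin n) ≡ true →
    ¬ HamiltonianCycle G
  not-closable⇒non-hamiltonian {out} lists certificate (x , xs , perm , path , back) =
    subst T (Equivalence.to T-not-≡ stuck) reached
    where
    x∷xs-unique : Unique (x ∷ xs)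
    x∷xs-unique =
      PermutationSetoid.Unique-resp-↭ (setoid (Fin n)) (↭⇒↭ₛ (↭-sym perm)) (allFin⁺ n)

    xs∉x : All (_∉ x ∷ []) xs
    xs∉x = All.map (λ { x≢z (here z≡x) → x≢z (sym z≡x) }) (AllPairs.head x∷xs-unique)

    length-xs : length xs ≡ pred n
    length-xs = cong pred (trans (↭-length perm) (length-tabulate {n = n} id))

    reached : T (closable out x (pred n) (x ∷ []) x)
    reached = subst (λ k → T (closable out x k (x ∷ []) x)) length-xs
      (closable-complete lists x (x ∷ []) x xs path back (AllPairs.tail x∷xs-unique) xs∉x)

    stuck : T (not (closable out x (pred n) (x ∷ []) x))
    stuck = All.lookup (all⁺ _ (allFin n) (Equivalence.from T-≡ certificate)) (∈-allFin x)

H-diregular : Diregular 3 H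
H-diregular = from-yes (all? λ v → (inDeg H v ≟ⁿ 3) ×-dec (outDeg H v ≟ⁿ 3))

H-oriented : Oriented H
H-oriented = from-yes (all? λ v → ¬? (arc? H v v))
           , λ u v → from-yes (all? λ u → all? λ v → arc? H u v →-dec ¬? (arc? H v u)) u v

H-out : Fin 12 → List (Fin 12)
H-out i = i +₁₂ 2 ∷ i +₁₂ 3 ∷ i +₁₂ 8 ∷ []

H-lists-out : ListsOutNeighbours H H-out
H-lists-out u _ (inj₁ refl)        = here refl
H-lists-out u _ (inj₂ (inj₁ refl)) = there (here refl)
H-lists-out u _ (inj₂ (inj₂ refl)) = there (there (here refl))

H-non-hamiltonian : ¬ HamiltonianCycle H
H-non-hamiltonian = not-closable⇒non-hamiltonian H H-lists-out refl

mainTheorem1 : (Diregular 3 H × Oriented H × 12 ≤ 4 * 3 + 1 × ¬ HamiltonianCycle H)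
    × ¬ (∀ (k n : ℕ) (G : Digraph n) → 1 ≤ k → k ≢ 2 → Diregular k G → Oriented G → n ≤ 4 * k + 1 → HamiltonianCycle G)
mainTheorem1 = (H-diregular , H-oriented , 12≤13 , H-non-hamiltonian)
             , λ conjecture → H-non-hamiltonian
                 (conjecture 3 12 H (s≤s z≤n) (λ ()) H-diregular H-oriented 12≤13)
  where
  12≤13 : 12 ≤ 4 * 3 + 1
  12≤13 = n≤1+n 12
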